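{- Let $\langle A,\twoheadrightarrow,\rightarrow,\top\rangle$ be a Semi-BCI algebra. Then for all $x,y,z\in A$: (8) if $x\ll y$ and $y\ll z$ then $x\ll z$; (9) if $x\ll y$ and $y\ll x$ then $x=y$; (10) $(y\twoheadrightarrow z)\preceq((z\twoheadrightarrow x)\rightarrow(y\twoheadrightarrow x))$; (11) if $\top\preceq x$ then $x=\top$; (12) $x\rightarrow x=\top$; (13) if $x\ll y$ then $x\preceq y$; (14) $x\twoheadrightarrow y\preceq x\rightarrow y$; (15) $x\rightarrow((x\rightarrow y)\rightarrow y)=\top$; (16) if $x\ll y$ then $x\twoheadrightarrow((x\twoheadrightarrow y)\twoheadrightarrow y)=\top$; (17) if $x\ll y$ then $z\twoheadrightarrow x\preceq z\twoheadrightarrow y$; (18) if $x\ll y$ then $y\twoheadrightarrow z\preceq x\twoheadrightarrow z$.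
   Context: A Semi-BCI (SBCI) algebra is a structure $\langle A,\twoheadrightarrow,\rightarrow,\top\rangle$ with two binary operations $\twoheadrightarrow,\rightarrow$ on $A$ and $\top\in A$, where $x\ll y$ iff $x\twoheadrightarrow y=\top$ and $x\preceq y$ iff $x\rightarrow y=\top$, such that for all $x,y,z\in A$: (S1) $x\twoheadrightarrow(y\twoheadrightarrow z)=y\twoheadrightarrow(x\twoheadrightarrow z)$; (S2) $x\rightarrow(y\rightarrow z)=y\rightarrow(x\rightarrow z)$; (S3) $x\twoheadrightarrow y\preceq(z\twoheadrightarrow x)\rightarrow(z\twoheadrightarrow y)$; (S4) $\top\twoheadrightarrow x=x$; (S5) if $x\ll y\preceq z$ then $x\ll z$; (S6) if $x\preceq y\ll z$ then $x\ll z$; (S7) if $x\preceq y$ and $y\preceq x$ then $x=y$. -}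

module Defs where

open import Level using (Level; suc)
open import Relation.Binary.PropositionalEquality using (_≡_)

record SBCI (a : Level) : Set (suc a) where
  infixr 5 _↠_ _⇒_
  infix 4 _≪_ _≼_
  field
    A   : Set a
    _↠_ : A → A → A
    _⇒_ : A → A → A
    ⊤   : A

  _≪_ : A → A → Set a
  x ≪ y = (x ↠ y) ≡ ⊤

  _≼_ : A → A → Set a
  x ≼ y = (x ⇒ y) ≡ ⊤

  field
    S1 : ∀ x y z → x ↠ (y ↠ z) ≡ y ↠ (x ↠ z)
    S2 : ∀ x y z → x ⇒ (y ⇒ z) ≡ y ⇒ (x ⇒ z)
    S3 : ∀ x y z → (x ↠ y) ≼ ((z ↠ x) ⇒ (z ↠ y))
    S4 : ∀ x → ⊤ ↠ x ≡ x
    S5 : ∀ {x y z} → x ≪ y → y ≼ z → x ≪ z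
    S6 : ∀ {x y z} → x ≼ y → y ≪ z → x ≪ z
    S7 : ∀ {x y} → x ≼ y → y ≼ x → x ≡ y

module Submission where

-- Everything rests on one observation: ⊤ is "closed upward" under ≼,
-- i.e. ⊤ ≼ w forces w ≡ ⊤ (via S4 and S5), hence a ≼-implication whose
-- antecedent equals ⊤ has consequent ⊤ (a modus ponens for ≼).
-- Specialising axiom S3 at z = ⊤ and simplifying with S4 gives
-- (x ↠ y) ≼ (x ⇒ y), so ≪ is contained in ≼; together with S5 and S7
-- this yields transitivity and antisymmetry of ≪.  Reflexivity of ⇒
-- comes from S3 at x = z = ⊤ plus exchange S2, and the remaining items
-- are instances of S3 (and its exchanged form, the suffixing law (10))
-- in which the antecedent collapses to ⊤ by modus ponens.

open import Defs
open import Level using (Level)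
open import Data.Product using (_×_; _,_)
open import Relation.Binary.PropositionalEquality
  using (_≡_; sym; trans; cong; cong₂; subst; module ≡-Reasoning)

module SBCIProperties {a : Level} (S : SBCI a) where
  open SBCI S
  open ≡-Reasoning

  ⊤≼⇒≡⊤ : ∀ {w} → ⊤ ≼ w → w ≡ ⊤
  ⊤≼⇒≡⊤ {w} ⊤≼w = begin
    w      ≡⟨ sym (S4 w) ⟩
    ⊤ ↠ w  ≡⟨ S5 (S4 ⊤) ⊤≼w ⟩
    ⊤      ∎

  ≼-mp : ∀ {u v} → u ≡ ⊤ → u ≼ v → v ≡ ⊤
  ≼-mp u≡⊤ u≼v = ⊤≼⇒≡⊤ (subst (λ t → t ≼ _) u≡⊤ u≼v)

  ↠≼⇒ : ∀ x y → (x ↠ y) ≼ (x ⇒ y)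
  ↠≼⇒ x y = subst (λ t → (x ↠ y) ≼ t) (cong₂ _⇒_ (S4 x) (S4 y)) (S3 x y ⊤)

  ≪⇒≼ : ∀ {x y} → x ≪ y → x ≼ y
  ≪⇒≼ {x} {y} x≪y = ≼-mp x≪y (↠≼⇒ x y)

  ⇒-refl : ∀ w → w ⇒ w ≡ ⊤
  ⇒-refl w = ⊤≼⇒≡⊤ (begin
    ⊤ ⇒ (w ⇒ w)                    ≡⟨ S2 ⊤ w w ⟩
    w ⇒ (⊤ ⇒ w)                    ≡⟨ sym (cong₂ (λ u v → u ⇒ (v ⇒ u)) (S4 w) (S4 ⊤)) ⟩
    (⊤ ↠ w) ⇒ ((⊤ ↠ ⊤) ⇒ (⊤ ↠ w))  ≡⟨ S3 ⊤ w ⊤ ⟩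
    ⊤                              ∎)

  ≪-trans : ∀ {x y z} → x ≪ y → y ≪ z → x ≪ z
  ≪-trans x≪y y≪z = S5 x≪y (≪⇒≼ y≪z)

  ≪-antisym : ∀ {x y} → x ≪ y → y ≪ x → x ≡ y
  ≪-antisym x≪y y≪x = S7 (≪⇒≼ x≪y) (≪⇒≼ y≪x)

  ↠-suffixing : ∀ x y z → (x ↠ y) ≼ ((y ↠ z) ⇒ (x ↠ z))
  ↠-suffixing x y z = begin
    (x ↠ y) ⇒ ((y ↠ z) ⇒ (x ↠ z))  ≡⟨ S2 (x ↠ y) (y ↠ z) (x ↠ z) ⟩
    (y ↠ z) ⇒ ((x ↠ y) ⇒ (x ↠ z))  ≡⟨ S3 y z x ⟩
    ⊤                              ∎

  ⇒-assertion : ∀ x y → x ⇒ ((x ⇒ y) ⇒ y) ≡ ⊤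
  ⇒-assertion x y = trans (S2 x (x ⇒ y) y) (⇒-refl (x ⇒ y))

  ↠-assertion : ∀ {x y} → x ≪ y → x ↠ ((x ↠ y) ↠ y) ≡ ⊤
  ↠-assertion {x} {y} x≪y = begin
    x ↠ ((x ↠ y) ↠ y)  ≡⟨ cong (λ t → x ↠ (t ↠ y)) x≪y ⟩
    x ↠ (⊤ ↠ y)        ≡⟨ cong (x ↠_) (S4 y) ⟩
    x ↠ y              ≡⟨ x≪y ⟩
    ⊤                  ∎

  ↠-monoʳ : ∀ {x y} z → x ≪ y → (z ↠ x) ≼ (z ↠ y)
  ↠-monoʳ {x} {y} z x≪y = ≼-mp x≪y (S3 x y z)

  ↠-antiˡ : ∀ {x y} z → x ≪ y → (y ↠ z) ≼ (x ↠ z)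
  ↠-antiˡ {x} {y} z x≪y = ≼-mp x≪y (↠-suffixing x y z)

proposition8 : ∀ {a : Level} (S : SBCI a) → let open SBCI S in
    ∀ (x y z : A) →
      (x ≪ y → y ≪ z → x ≪ z)
    × (x ≪ y → y ≪ x → x ≡ y)
    × ((y ↠ z) ≼ ((z ↠ x) ⇒ (y ↠ x)))
    × (⊤ ≼ x → x ≡ ⊤)
    × (x ⇒ x ≡ ⊤)
    × (x ≪ y → x ≼ y)
    × ((x ↠ y) ≼ (x ⇒ y))
    × (x ⇒ ((x ⇒ y) ⇒ y) ≡ ⊤)
    × (x ≪ y → x ↠ ((x ↠ y) ↠ y) ≡ ⊤)
    × (x ≪ y → (z ↠ x) ≼ (z ↠ y))
    × (x ≪ y → (y ↠ z) ≼ (x ↠ z))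
proposition8 S x y z =
    ≪-trans
  , ≪-antisym
  , ↠-suffixing y z x
  , ⊤≼⇒≡⊤
  , ⇒-refl x
  , ≪⇒≼
  , ↠≼⇒ x y
  , ⇒-assertion x y
  , ↠-assertion
  , ↠-monoʳ z
  , ↠-antiˡ z
  where open SBCIProperties S
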